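{- Let $\Sigma=\{a,b,c\}$ and let $\mathcal{L}_\cup$ be the set of non-empty words $w\in\Sigma^*$ such that the number of occurrences of $c$ in $w$ is greater than the number of occurrences of $b$, or is greater than the number of occurrences of $a$. Then $\mathcal{L}_\cup$ is not PODWA-recognizable, i.e., there is no binary PODWA $\Lambda$ over $\Sigma$ such that for every non-empty word $w$, $\mathcal{L}(\Lambda)(w)=1$ if and only if $w\in\mathcal{L}_\cup$.
   Context: A deterministic weighted automaton (DWA) is a tuple $\mathcal{A}=\langle \Sigma, Q, q_0,\delta,\mathbf{c}\rangle$ with finite alphabet $\Sigma$, finite state set $Q$, initial state $q_0\in Q$, transition function $\delta\colon Q\times\Sigma\to Q$ and weight function $\mathbf{c}\colon Q\times\Sigma\to\mathbb{Z}$. Extend $\delta$ to $\hat\delta\colon Q\times\Sigma^*\to Q$ by $\hat\delta(q,\epsilon)=q$, $\hat\delta(q,wa)=\delta(\hat\delta(q,w),a)$. For a non-empty word $w=w[1]\cdots w[k]$, the value $\mathcal{L}(\mathcal{A})(w)=\sum_{i=1}^{k}\mathbf{c}(\hat\delta(q_0,w[1]\cdots w[i-1]),w[i])$. A partially-observable DWA (PODWA) is a pair $\Lambda=(\mathcal{A},S)$ where $\mathcal{A}$ is a DWA and $S$ is a finite set of pairwise-disjoint intervals covering $\mathbb{Z}$, enumerated $0,\dots,s$ according to the order on $\mathbb{Z}$; its language $\mathcal{L}(\Lambda)$ maps each non-empty word $w$ to the index of the interval of $S$ containing $\mathcal{L}(\mathcal{A})(w)$. A binary PODWA is a PODWA with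 $S=\{(-\infty,0],(0,+\infty)\}$; words with value in $(0,+\infty)$ (index $1$) are called accepted. -}

module Defs where

open import Data.Nat using (ℕ; zero; suc)
open import Data.Fin using (Fin)
open import Data.Integer using (ℤ; +_; _+_; _≤_; _>_)
open import Data.List using (List; []; _∷_; foldl; length; filter)
open import Data.Product using (_×_; _,_)
import Data.Nat
import Relation.Nullary
open import Data.Sum using (_⊎_)
open import Relation.Binary.PropositionalEquality using (_≡_; _≢_)

record DWA (Σ : Set) : Set where
  field
    n     : ℕ
    q₀    : Fin n
    δ     : Fin n → Σ → Fin n
    c     : Fin n → Σ → ℤ

module _ {Σ : Set} (A : DWA Σ) where
  open DWA A

  δ̂ : Fin n → List Σ → Fin n
  δ̂ q []      = q
  δ̂ q (x ∷ w) = δ̂ (δ q x) w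

  val : Fin n → List Σ → ℤ
  val q []      = + 0
  val q (x ∷ w) = c q x + val (δ q x) w

  value : List Σ → ℤ
  value w = val q₀ w

-- Intervals of a PODWA partition. A binary PODWA has S = {(-∞,0], (0,+∞)},
-- so it is determined by its DWA; its language gives index 1 iff value > 0.
data Index : Set where
  idx0 idx1 : Index

binaryOutput : {Σ : Set} → DWA Σ → List Σ → Index
binaryOutput A w with value A w Data.Integer.≤? + 0
... | Relation.Nullary.yes _ = idx0
... | Relation.Nullary.no  _ = idx1

data Letter : Set where
  a b c : Letter

eqℕ : Letter → Letter → ℕ
eqℕ a a = 1
eqℕ b b = 1
eqℕ c c = 1
eqℕ _ _ = 0

count : Letter → List Letter → ℕ
count x []      = 0
count x (y ∷ w) = eqℕ x y Data.Nat.+ count x w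

NonEmpty : {A : Set} → List A → Set
NonEmpty w = w ≢ []

-- w ∈ L∪ : #c(w) > #b(w) or #c(w) > #a(w)  (non-emptiness imposed separately)
InLcup : List Letter → Set
InLcup w = (count b w Data.Nat.< count c w) ⊎ (count a w Data.Nat.< count c w)

-- A DWA reads a word left to right, so the value of u v is the value of u
-- plus a quantity depending only on the state reached after u and on v.
-- Hence if u and u′ reach the same state, val(u v) + val(u′ v′) =
-- val(u v′) + val(u′ v), and the "crossing" pattern u v, u′ v′ accepted
-- but u v′, u′ v rejected is impossible for a binary PODWA.  Among the
-- n + 1 prefixes aᵏ bⁿ⁻ᵏ two, aⁱ bⁿ⁻ⁱ and aʲ bⁿ⁻ʲ with i < j, reach the
-- same state; the suffixes bⁿ cʲ and aⁿ cⁿ⁻ⁱ produce the crossing pattern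
-- for L∪, the first through the disjunct #c > #a, the second through
-- #c > #b.
module Submission where

open import Defs
open import Data.List using (List)
open import Data.Product using (Σ)
open import Relation.Binary.PropositionalEquality using (_≡_)
open import Relation.Nullary using (¬_)
open import Function.Bundles using (_⇔_)

open import Data.Empty using (⊥)
open import Data.Fin using (toℕ)
import Data.Fin.Properties as Fin
open import Data.Integer as ℤ using (ℤ; +_)
import Data.Integer.Properties as ℤ
open import Data.Integer.Solver using (module +-*-Solver)
open import Data.List using ([]; _∷_; _++_; replicate)
open import Data.List.Properties using (++-conicalʳ)
open import Data.Nat as ℕ using (ℕ; zero; suc; _∸_; _<_; _≤_)
import Data.Nat.Properties as ℕ
open import Data.Product using (∃₂; _×_; _,_)
open import Data.Sum using (_⊎_; inj₁; inj₂; [_,_])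
open import Function.Bundles using (Equivalence; mk⇔)
open import Relation.Binary.PropositionalEquality
  using (refl; sym; trans; cong; cong₂; subst; module ≡-Reasoning)
open import Relation.Nullary using (yes; no; contradiction)

Recognises : {Σ : Set} → DWA Σ → (List Σ → Set) → Set
Recognises A L = (w : List _) → NonEmpty w → (binaryOutput A w ≡ idx1 ⇔ L w)

++-nonEmptyʳ : {A : Set} (xs : List A) {ys : List A} → NonEmpty ys → NonEmpty (xs ++ ys)
++-nonEmptyʳ xs {ys} ys≢[] xs++ys≡[] = ys≢[] (++-conicalʳ xs ys xs++ys≡[])

replicate-nonEmpty : {A : Set} {k : ℕ} (x : A) → 0 < k → NonEmpty (replicate k x)
replicate-nonEmpty {k = suc _} x _ ()

module _ {Σ : Set} (A : DWA Σ) where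
  open DWA A using (q₀)

  val-++ : ∀ q u v → val A q (u ++ v) ≡ val A q u ℤ.+ val A (δ̂ A q u) v
  val-++ q []      v = sym (ℤ.+-identityˡ _)
  val-++ q (x ∷ u) v rewrite val-++ (DWA.δ A q x) u v = sym (ℤ.+-assoc (DWA.c A q x) _ _)

  value-++-via : ∀ {q} u v → δ̂ A q₀ u ≡ q → value A (u ++ v) ≡ val A q₀ u ℤ.+ val A q v
  value-++-via u v refl = val-++ q₀ u v

  value-++-exchange : ∀ u u′ v v′ → δ̂ A q₀ u ≡ δ̂ A q₀ u′ →
    value A (u ++ v) ℤ.+ value A (u′ ++ v′) ≡ value A (u ++ v′) ℤ.+ value A (u′ ++ v)
  value-++-exchange u u′ v v′ same = begin
    value A (u ++ v) ℤ.+ value A (u′ ++ v′)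
      ≡⟨ cong₂ ℤ._+_ (value-++-via u v same) (value-++-via u′ v′ refl) ⟩
    (val A q₀ u ℤ.+ val A q v) ℤ.+ (val A q₀ u′ ℤ.+ val A q v′)
      ≡⟨ interchange (val A q₀ u) (val A q v) (val A q₀ u′) (val A q v′) ⟩
    (val A q₀ u ℤ.+ val A q v′) ℤ.+ (val A q₀ u′ ℤ.+ val A q v)
      ≡⟨ sym (cong₂ ℤ._+_ (value-++-via u v′ same) (value-++-via u′ v refl)) ⟩
    value A (u ++ v′) ℤ.+ value A (u′ ++ v) ∎
    where
    open ≡-Reasoning
    open +-*-Solver
    q = δ̂ A q₀ u′
    interchange : ∀ x y x′ y′ → (x ℤ.+ y) ℤ.+ (x′ ℤ.+ y′) ≡ (x ℤ.+ y′) ℤ.+ (x′ ℤ.+ y)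
    interchange = solve 4 (λ x y x′ y′ → (x :+ y) :+ (x′ :+ y′) := (x :+ y′) :+ (x′ :+ y)) refl

  binaryOutput≡idx1⇔positive : ∀ w → binaryOutput A w ≡ idx1 ⇔ + 0 ℤ.< value A w
  binaryOutput≡idx1⇔positive w with value A w ℤ.≤? + 0
  ... | yes v≤0 = mk⇔ (λ ()) (λ 0<v → contradiction v≤0 (ℤ.<⇒≱ 0<v))
  ... | no  v≰0 = mk⇔ (λ _ → ℤ.≰⇒> v≰0) (λ _ → refl)

  δ̂-collision : (u : ℕ → List Σ) →
    ∃₂ λ i j → i < j × j ≤ DWA.n A × δ̂ A q₀ (u i) ≡ δ̂ A q₀ (u j)
  δ̂-collision u with Fin.pigeonhole (ℕ.n<1+n (DWA.n A)) (λ k → δ̂ A q₀ (u (toℕ k)))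
  ... | i , j , i<j , same = toℕ i , toℕ j , i<j , Fin.toℕ≤pred[n] j , same

  recognised-no-crossing : ∀ {L} → Recognises A L → ∀ u u′ v v′ → δ̂ A q₀ u ≡ δ̂ A q₀ u′ →
    NonEmpty v → NonEmpty v′ →
    L (u ++ v) → L (u′ ++ v′) → ¬ L (u ++ v′) → ¬ L (u′ ++ v) → ⊥
  recognised-no-crossing {L} H u u′ v v′ same v≢[] v′≢[] uv u′v′ ¬uv′ ¬u′v =
    ℤ.<⇒≱ (ℤ.+-mono-< (accepted u uv v≢[]) (accepted u′ u′v′ v′≢[]))
          (subst (ℤ._≤ + 0) (sym (value-++-exchange u u′ v v′ same))
                 (ℤ.+-mono-≤ (rejected u ¬uv′ v′≢[]) (rejected u′ ¬u′v v≢[])))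
    where
    accepted : ∀ x {y} → L (x ++ y) → NonEmpty y → + 0 ℤ.< value A (x ++ y)
    accepted x {y} xy y≢[] = Equivalence.to (binaryOutput≡idx1⇔positive (x ++ y))
      (Equivalence.from (H (x ++ y) (++-nonEmptyʳ x y≢[])) xy)
    rejected : ∀ x {y} → ¬ L (x ++ y) → NonEmpty y → value A (x ++ y) ℤ.≤ + 0
    rejected x {y} ¬xy y≢[] = ℤ.≮⇒≥ λ 0<v → ¬xy (Equivalence.to (H (x ++ y) (++-nonEmptyʳ x y≢[]))
      (Equivalence.from (binaryOutput≡idx1⇔positive (x ++ y)) 0<v))

count-++ : ∀ x u v → count x (u ++ v) ≡ count x u ℕ.+ count x v
count-++ x []      v = refl
count-++ x (y ∷ u) v rewrite count-++ x u v = sym (ℕ.+-assoc (eqℕ x y) _ _)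

count-replicate : ∀ x y k → count x (replicate k y) ≡ k ℕ.* eqℕ x y
count-replicate x y zero    = refl
count-replicate x y (suc k) = cong (eqℕ x y ℕ.+_) (count-replicate x y k)

record Counts (w : List Letter) (i j k : ℕ) : Set where
  constructor counts
  field
    #a : count a w ≡ i
    #b : count b w ≡ j
    #c : count c w ≡ k

Counts-++ : ∀ {u v i j k i′ j′ k′} → Counts u i j k → Counts v i′ j′ k′ →
  Counts (u ++ v) (i ℕ.+ i′) (j ℕ.+ j′) (k ℕ.+ k′)
Counts-++ {u} {v} (counts refl refl refl) (counts refl refl refl) =
  counts (count-++ a u v) (count-++ b u v) (count-++ c u v)

Counts-replicate-a : ∀ k → Counts (replicate k a) k 0 0
Counts-replicate-a k = counts
  (trans (count-replicate a a k) (ℕ.*-identityʳ k))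
  (trans (count-replicate b a k) (ℕ.*-zeroʳ k))
  (trans (count-replicate c a k) (ℕ.*-zeroʳ k))

Counts-replicate-b : ∀ k → Counts (replicate k b) 0 k 0
Counts-replicate-b k = counts
  (trans (count-replicate a b k) (ℕ.*-zeroʳ k))
  (trans (count-replicate b b k) (ℕ.*-identityʳ k))
  (trans (count-replicate c b k) (ℕ.*-zeroʳ k))

Counts-replicate-c : ∀ k → Counts (replicate k c) 0 0 k
Counts-replicate-c k = counts
  (trans (count-replicate a c k) (ℕ.*-zeroʳ k))
  (trans (count-replicate b c k) (ℕ.*-zeroʳ k))
  (trans (count-replicate c c k) (ℕ.*-identityʳ k))

Counts⇒InLcup : ∀ {w i j k} → Counts w i j k → j < k ⊎ i < k → InLcup w
Counts⇒InLcup (counts refl refl refl) h = h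

Counts⇒¬InLcup : ∀ {w i j k} → Counts w i j k → ¬ j < k → ¬ i < k → ¬ InLcup w
Counts⇒¬InLcup (counts refl refl refl) j≮k i≮k = [ j≮k , i≮k ]

module Witnesses (n : ℕ) where

  aᵏbⁿ⁻ᵏ bⁿcᵏ aⁿcᵏ : ℕ → List Letter
  aᵏbⁿ⁻ᵏ k = replicate k a ++ replicate (n ∸ k) b
  bⁿcᵏ   k = replicate n b ++ replicate k c
  aⁿcᵏ   k = replicate n a ++ replicate k c

  Counts-aᵏbⁿ⁻ᵏ : ∀ k → Counts (aᵏbⁿ⁻ᵏ k) k (n ∸ k) 0
  Counts-aᵏbⁿ⁻ᵏ k with Counts-++ (Counts-replicate-a k) (Counts-replicate-b (n ∸ k))
  ... | counts #a #b #c = counts (trans #a (ℕ.+-identityʳ k)) #b #c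

  Counts-bⁿcᵏ : ∀ k → Counts (bⁿcᵏ k) 0 n k
  Counts-bⁿcᵏ k with Counts-++ (Counts-replicate-b n) (Counts-replicate-c k)
  ... | counts #a #b #c = counts #a (trans #b (ℕ.+-identityʳ n)) #c

  Counts-aⁿcᵏ : ∀ k → Counts (aⁿcᵏ k) n 0 k
  Counts-aⁿcᵏ k with Counts-++ (Counts-replicate-a n) (Counts-replicate-c k)
  ... | counts #a #b #c = counts (trans #a (ℕ.+-identityʳ n)) #b #c

  module _ {i j : ℕ} (i<j : i < j) (j≤n : j ≤ n) where

    aⁱbⁿ⁻ⁱbⁿcʲ∈Lcup : InLcup (aᵏbⁿ⁻ᵏ i ++ bⁿcᵏ j)
    aⁱbⁿ⁻ⁱbⁿcʲ∈Lcup = Counts⇒InLcup (Counts-++ (Counts-aᵏbⁿ⁻ᵏ i) (Counts-bⁿcᵏ j))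
      (inj₂ (subst (_< j) (sym (ℕ.+-identityʳ i)) i<j))

    aʲbⁿ⁻ʲaⁿcⁿ⁻ⁱ∈Lcup : InLcup (aᵏbⁿ⁻ᵏ j ++ aⁿcᵏ (n ∸ i))
    aʲbⁿ⁻ʲaⁿcⁿ⁻ⁱ∈Lcup = Counts⇒InLcup (Counts-++ (Counts-aᵏbⁿ⁻ᵏ j) (Counts-aⁿcᵏ (n ∸ i)))
      (inj₁ (subst (_< n ∸ i) (sym (ℕ.+-identityʳ (n ∸ j))) (ℕ.∸-monoʳ-< i<j j≤n)))

    aⁱbⁿ⁻ⁱaⁿcⁿ⁻ⁱ∉Lcup : ¬ InLcup (aᵏbⁿ⁻ᵏ i ++ aⁿcᵏ (n ∸ i))
    aⁱbⁿ⁻ⁱaⁿcⁿ⁻ⁱ∉Lcup = Counts⇒¬InLcup (Counts-++ (Counts-aᵏbⁿ⁻ᵏ i) (Counts-aⁿcᵏ (n ∸ i)))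
      (ℕ.m+n≮m (n ∸ i) 0)
      (ℕ.≤⇒≯ (ℕ.≤-trans (ℕ.m∸n≤m n i) (ℕ.m≤n+m n i)))

    aʲbⁿ⁻ʲbⁿcʲ∉Lcup : ¬ InLcup (aᵏbⁿ⁻ᵏ j ++ bⁿcᵏ j)
    aʲbⁿ⁻ʲbⁿcʲ∉Lcup = Counts⇒¬InLcup (Counts-++ (Counts-aᵏbⁿ⁻ᵏ j) (Counts-bⁿcᵏ j))
      (ℕ.≤⇒≯ (ℕ.≤-trans j≤n (ℕ.m≤n+m n (n ∸ j))))
      (ℕ.m+n≮m j 0)

Lcup-not-recognised : (A : DWA Letter) → ¬ Recognises A InLcup
Lcup-not-recognised A H with δ̂-collision A (Witnesses.aᵏbⁿ⁻ᵏ (DWA.n A))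
... | i , j , i<j , j≤n , same = recognised-no-crossing A H
  (aᵏbⁿ⁻ᵏ i) (aᵏbⁿ⁻ᵏ j) (bⁿcᵏ j) (aⁿcᵏ (n ∸ i)) same
  (++-nonEmptyʳ (replicate n b) (replicate-nonEmpty c 0<j))
  (++-nonEmptyʳ (replicate n a) (replicate-nonEmpty c (ℕ.m<n⇒0<n∸m (ℕ.<-≤-trans i<j j≤n))))
  (aⁱbⁿ⁻ⁱbⁿcʲ∈Lcup i<j j≤n) (aʲbⁿ⁻ʲaⁿcⁿ⁻ⁱ∈Lcup i<j j≤n)
  (aⁱbⁿ⁻ⁱaⁿcⁿ⁻ⁱ∉Lcup i<j j≤n) (aʲbⁿ⁻ʲbⁿcʲ∉Lcup i<j j≤n)
  where
  n = DWA.n A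
  open Witnesses n
  0<j : 0 < j
  0<j = ℕ.≤-<-trans ℕ.z≤n i<j

lemma1 : ¬ (Σ (DWA Letter) λ A →
           (w : List Letter) → NonEmpty w → (binaryOutput A w ≡ idx1 ⇔ InLcup w))
lemma1 (A , H) = Lcup-not-recognised A H
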